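{- Let $v\in S_n$ avoid $2143$ and $1324$, and choose $i\in[n]$. Let $x\in S_{n-1}$ be the permutation $x:\delta_i(j)\mapsto \delta_{v_i}(v_j)$ for $j\neq i$ (i.e. $x$ is obtained by deleting $v_i$ from the one-line notation of $v$ and shifting the remaining values). Then for every $(n-1)\times(n-1)$ matrix $M$, \[\det\left(M|_{\Gamma_{[x,w_0]}}\right)=\det\left(M|_{(\Gamma_{[v,w_0]})^{v_i}_{i}}\right).\]
   Context: $S_n$ is the symmetric group in one-line notation, $w_0$ the longest element (of the relevant $S_m$), Bruhat order as usual. $\Gamma_{[u,w_0]}:=\{(r,u'_r): u'\geq u,\ r\}$ is the set of cells (row $r$, column $u'_r$) occupied by permutations in the Bruhat interval. For $a\in[n]$, $\delta_a:[n]\setminus\{a\}\to[n-1]$ is $\delta_a(j)=j$ if $j<a$ and $\delta_a(j)=j-1$ if $j>a$. For $P\subseteq[n]^2$, $P^k_i := \{(\delta_i(r),\delta_k(c)) : (r,c)\in P,\ r\ne i,\ c\ne k\}\subseteq[n-1]^2$ ($P$ with row $i$ and column $k$ deleted). For $Q\subseteq[m]^2$ and an $m\times m$ matrix $M=(m_{rc})$, $M|_Q$ has $(r,c)$ entry $m_{rc}$ if $(r,c)\in Q$ and $0$ otherwise. -}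

module Defs where

open import Level using (Level; _⊔_; 0ℓ)
open import Data.Nat.Base using (ℕ; zero; suc)
open import Data.Fin.Base using (Fin; zero; suc; punchIn; punchOut; _<_)
open import Data.Fin.Permutation using (Permutation′; _⟨$⟩ʳ_)
import Data.Fin.Permutation.Components as PC
open import Data.Product using (Σ; ∃; _×_; _,_)
open import Relation.Nullary using (Dec; does; ¬_)
open import Relation.Binary.PropositionalEquality using (_≡_; _≢_)
open import Relation.Binary.Construct.Closure.ReflexiveTransitive using (Star)
open import Algebra.Bundles using (CommutativeRing)
open import Data.Bool.Base using (if_then_else_)

-- Permutations of [n] = Fin n, one-line notation w = (w ⟨$⟩ʳ 0, …).

-- Covering-type generator of Bruhat order: w = u · (a b) with a < b and
-- u(a) < u(b), i.e. w is obtained from u by swapping the entries in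
-- positions a < b of the one-line notation when they form a non-inversion
-- (this increases the length).
BruhatStep : ∀ {n} → Permutation′ n → Permutation′ n → Set
BruhatStep {n} u w =
  Σ (Fin n) λ a → Σ (Fin n) λ b →
    (a < b) × ((u ⟨$⟩ʳ a) < (u ⟨$⟩ʳ b)) ×
    (∀ k → w ⟨$⟩ʳ k ≡ u ⟨$⟩ʳ (PC.transpose a b k))

_≤B_ : ∀ {n} → Permutation′ n → Permutation′ n → Set
_≤B_ = Star BruhatStep

Contains2143 : ∀ {n} → Permutation′ n → Set
Contains2143 {n} v =
  Σ (Fin n) λ a → Σ (Fin n) λ b → Σ (Fin n) λ c → Σ (Fin n) λ d →
    (a < b) × (b < c) × (c < d) ×
    ((v ⟨$⟩ʳ b) < (v ⟨$⟩ʳ a)) × ((v ⟨$⟩ʳ a) < (v ⟨$⟩ʳ d)) × ((v ⟨$⟩ʳ d) < (v ⟨$⟩ʳ c))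

Contains1324 : ∀ {n} → Permutation′ n → Set
Contains1324 {n} v =
  Σ (Fin n) λ a → Σ (Fin n) λ b → Σ (Fin n) λ c → Σ (Fin n) λ d →
    (a < b) × (b < c) × (c < d) ×
    ((v ⟨$⟩ʳ a) < (v ⟨$⟩ʳ c)) × ((v ⟨$⟩ʳ c) < (v ⟨$⟩ʳ b)) × ((v ⟨$⟩ʳ b) < (v ⟨$⟩ʳ d))

-- Cell sets, as predicates on (row, column).

Cells : ℕ → Set₁
Cells n = Fin n → Fin n → Set

Γ : ∀ {n} → Permutation′ n → Cells n
Γ {n} u r c = Σ (Permutation′ n) λ u' → (u ≤B u') × (u' ⟨$⟩ʳ r ≡ c)

-- P^k_i : delete row i and column k, reindexing by δ_i, δ_k (= punchOut).
delRC : ∀ {n} → Cells (suc n) → Fin (suc n) → Fin (suc n) → Cells n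
delRC {n} P i k r' c' =
  Σ (Fin (suc n)) λ r → Σ (Fin (suc n)) λ c →
    Σ (i ≢ r) λ i≢r → Σ (k ≢ c) λ k≢c →
      P r c × (punchOut i≢r ≡ r') × (punchOut k≢c ≡ c')

module Matrices {c ℓ : Level} (R : CommutativeRing c ℓ) where
  open CommutativeRing R using (0#; 1#; _+_; _*_; -_) renaming (Carrier to A)

  Matrix : ℕ → Set c
  Matrix n = Fin n → Fin n → A

  restrict : ∀ {n} (Q : Cells n) → (∀ r c → Dec (Q r c)) → Matrix n → Matrix n
  restrict Q dec M r c = if does (dec r c) then M r c else 0#

  sumFin : ∀ {n} → (Fin n → A) → A
  sumFin {zero}  f = 0#
  sumFin {suc n} f = f zero + sumFin (λ j → f (suc j))

  altSign : ∀ {n} → Fin n → A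
  altSign zero    = 1#
  altSign (suc j) = - altSign j

  det : ∀ {n} → Matrix n → A
  det {zero}  M = 1#
  det {suc n} M =
    sumFin (λ j → altSign j * (M zero j * det (λ r c → M (suc r) (punchIn j c))))

module Submission where

-- (1) Bands: Γ_{[u,w₀]} is the set of cells (r, c) having an entry of u
--     weakly north-west and one weakly south-east of them (Bruhat steps
--     shrink bands; band cells are reached in at most two steps).
-- (2) det (M|_Q) ≈ det (M|_P) whenever Q ⊆ P and every permutation
--     supported in P is supported in Q (first-row Laplace expansion).
-- (3) With p = v_i, x = remove i v and D = (Γ_{[v,w₀]})^p_i, the band of x
--     lifts into that of v, so Γ_{[x,w₀]} ⊆ D.  Conversely, if σ is supported
--     in D, inserting p in row i gives τ in the band of v, and the key lemma
--     (module OffRow: 2143/1324-avoidance plus pigeonhole) moves the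
--     north-west witnesses of τ's cells off row i.  Stated for any strict
--     total order, it also handles south-east witnesses via the reversed
--     order (rotation by 180° preserves both patterns).  So σ lies in the
--     band of x, i.e. is supported in Γ_{[x,w₀]}, and (2) concludes.

open import Defs
open import Level using (Level; 0ℓ)
open import Data.Nat.Base using (ℕ; suc)
open import Data.Fin.Base using (Fin)
open import Data.Fin.Permutation using (Permutation′; _⟨$⟩ʳ_; remove)
open import Relation.Nullary using (Dec; ¬_)
open import Algebra.Bundles using (CommutativeRing)

import Data.Nat.Base as ℕ
import Data.Nat.Properties as ℕ
open import Data.Bool.Base using (Bool; true; false; _∨_)
open import Data.Fin.Base using (zero; suc; _<_; punchIn; punchOut)
open import Data.Fin.Properties
  using (_≟_; any?; <-cmp; <-trans; <-irrefl; <-isStrictTotalOrder; ≤∧≢⇒<; <⇒≢;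
         punchIn-mono-≤; punchIn-cancel-≤; punchIn-injective; punchInᵢ≢i;
         punchOut-injective; punchIn-punchOut; punchOut-punchIn)
open import Data.Fin.Permutation
  using (_⟨$⟩ˡ_; inverseˡ; inverseʳ; transpose; _∘ₚ_; id; insert; insert-punchIn; punchIn-permute)
import Data.Fin.Permutation.Components as PC
open import Data.Product using (∃; _×_; _,_; proj₁; proj₂)
open import Data.Sum using (_⊎_; inj₁; inj₂)
open import Data.Empty using (⊥; ⊥-elim)
open import Function.Base using (_∘_; flip)
open import Function.Definitions using (Injective)
open import Relation.Nullary using (yes; no; does; contradiction)
open import Relation.Nullary.Decidable using (_×-dec_; _⊎-dec_; ¬?)
open import Relation.Binary.Core using (Rel)
open import Relation.Binary.Definitions using (Tri; tri<; tri≈; tri>; Trichotomous)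
open import Relation.Binary.Structures using (IsStrictTotalOrder)
open import Relation.Binary.PropositionalEquality
  using (_≡_; _≢_; refl; sym; trans; cong; subst; subst₂; isEquivalence; resp₂)
import Relation.Binary.Construct.StrictToNonStrict as StrictToNonStrict
open import Relation.Binary.Construct.Closure.ReflexiveTransitive using (ε; _◅_; _◅◅_)

⟨$⟩ʳ-injective : ∀ {n} (π : Permutation′ n) → Injective _≡_ _≡_ (π ⟨$⟩ʳ_)
⟨$⟩ʳ-injective π {a} {b} e = trans (sym (inverseˡ π)) (trans (cong (π ⟨$⟩ˡ_) e) (inverseˡ π))

⟨$⟩ˡ-injective : ∀ {n} (π : Permutation′ n) → Injective _≡_ _≡_ (π ⟨$⟩ˡ_)
⟨$⟩ˡ-injective π {a} {b} e = trans (sym (inverseʳ π)) (trans (cong (π ⟨$⟩ʳ_) e) (inverseʳ π))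

module Quadrants {n : ℕ} {_≺_ : Rel (Fin n) 0ℓ} (O : IsStrictTotalOrder _≡_ _≺_) where
  open IsStrictTotalOrder O public using (compare)
    renaming (trans to ≺-trans; irrefl to ≺-irrefl; _<?_ to _≺?_)

  open StrictToNonStrict _≡_ _≺_ public using () renaming (_≤_ to _≼_)

  infix 4 _≽_
  _≽_ : Rel (Fin n) 0ℓ
  a ≽ b = b ≺ a ⊎ a ≡ b

  _≼?_ : ∀ a b → Dec (a ≼ b)
  _≼?_ = StrictToNonStrict.decidable′ _≡_ _≺_ compare

  ≽⇒≼ : ∀ {a b} → a ≽ b → b ≼ a
  ≽⇒≼ (inj₁ b≺a) = inj₁ b≺a
  ≽⇒≼ (inj₂ a≡b) = inj₂ (sym a≡b)

  ≼⇒≽ : ∀ {a b} → a ≼ b → b ≽ a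
  ≼⇒≽ (inj₁ a≺b) = inj₁ a≺b
  ≼⇒≽ (inj₂ a≡b) = inj₂ (sym a≡b)

  ≼-≺-trans : ∀ {a b c} → a ≼ b → b ≺ c → a ≺ c
  ≼-≺-trans = StrictToNonStrict.≤-<-trans _≡_ _≺_ sym ≺-trans (resp₂ _≺_ .proj₂)

  ≺-≼-trans : ∀ {a b c} → a ≺ b → b ≼ c → a ≺ c
  ≺-≼-trans = StrictToNonStrict.<-≤-trans _≡_ _≺_ ≺-trans (resp₂ _≺_ .proj₁)

  ≼-trans : ∀ {a b c} → a ≼ b → b ≼ c → a ≼ c
  ≼-trans = StrictToNonStrict.trans _≡_ _≺_ isEquivalence (resp₂ _≺_) ≺-trans

  ≼⇒≯ : ∀ {a b} → a ≼ b → ¬ b ≺ a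
  ≼⇒≯ a≼b b≺a = ≺-irrefl refl (≼-≺-trans a≼b b≺a)

  ≼∧≢⇒≺ : ∀ {a b} → a ≼ b → a ≢ b → a ≺ b
  ≼∧≢⇒≺ (inj₁ a≺b) _ = a≺b
  ≼∧≢⇒≺ (inj₂ a≡b) a≢b = contradiction a≡b a≢b

  ≼⊎≻ : ∀ a b → a ≼ b ⊎ b ≺ a
  ≼⊎≻ a b with compare a b
  ... | tri< a≺b _ _ = inj₁ (inj₁ a≺b)
  ... | tri≈ _ a≡b _ = inj₁ (inj₂ a≡b)
  ... | tri> _ _ b≺a = inj₂ b≺a

  NW SE : (Fin n → Fin n) → Fin n → Fin n → Set
  NW u r c = ∃ λ a → a ≼ r × u a ≼ c
  SE u r c = ∃ λ a → a ≽ r × u a ≽ c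

  Avoids2143 Avoids1324 : (Fin n → Fin n) → Set
  Avoids2143 u = ∀ {a b c d} → a ≺ b → b ≺ c → c ≺ d →
                 u b ≺ u a → u a ≺ u d → u d ≺ u c → ⊥
  Avoids1324 u = ∀ {a b c d} → a ≺ b → b ≺ c → c ≺ d →
                 u a ≺ u c → u c ≺ u b → u b ≺ u d → ⊥

-- The reversed order on Fin n; quadrants for it are the rotated quadrants.
reversed : ∀ {n} → IsStrictTotalOrder _≡_ (flip (_<_ {n}))
reversed = record
  { isStrictPartialOrder = record
    { isEquivalence = isEquivalence
    ; irrefl        = λ a≡b b<a → <-irrefl (sym a≡b) b<a
    ; trans         = λ b<a c<b → <-trans c<b b<a
    ; <-resp-≈      = resp₂ (flip _<_)
    }
  ; compare = compare
  }
  where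
  compare : ∀ {n} → Trichotomous _≡_ (flip (_<_ {n}))
  compare a b with <-cmp a b
  ... | tri< a<b a≢b b≮a = tri> b≮a a≢b a<b
  ... | tri≈ a≮b a≡b b≮a = tri≈ b≮a a≡b a≮b
  ... | tri> a≮b a≢b b<a = tri< b<a a≢b a≮b

module Std {n : ℕ} = Quadrants (<-isStrictTotalOrder {n})
module Rev {n : ℕ} = Quadrants (reversed {n})

-- Both patterns are invariant under rotation by 180°.
avoids2143 : ∀ {n} {v : Permutation′ n} → ¬ Contains2143 v → Std.Avoids2143 (v ⟨$⟩ʳ_)
avoids2143 ¬2143 a<b b<c c<d h₁ h₂ h₃ = ¬2143 (_ , _ , _ , _ , a<b , b<c , c<d , h₁ , h₂ , h₃)

avoids2143ʳ : ∀ {n} {v : Permutation′ n} → ¬ Contains2143 v → Rev.Avoids2143 (v ⟨$⟩ʳ_)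
avoids2143ʳ ¬2143 b<a c<b d<c h₁ h₂ h₃ = ¬2143 (_ , _ , _ , _ , d<c , c<b , b<a , h₃ , h₂ , h₁)

avoids1324 : ∀ {n} {v : Permutation′ n} → ¬ Contains1324 v → Std.Avoids1324 (v ⟨$⟩ʳ_)
avoids1324 ¬1324 a<b b<c c<d h₁ h₂ h₃ = ¬1324 (_ , _ , _ , _ , a<b , b<c , c<d , h₁ , h₂ , h₃)

avoids1324ʳ : ∀ {n} {v : Permutation′ n} → ¬ Contains1324 v → Rev.Avoids1324 (v ⟨$⟩ʳ_)
avoids1324ʳ ¬1324 b<a c<b d<c h₁ h₂ h₃ = ¬1324 (_ , _ , _ , _ , d<c , c<b , b<a , h₃ , h₂ , h₁)

module Counting where
  open ℕ.≤-Reasoning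
  open import Algebra.Properties.CommutativeSemigroup ℕ.+-commutativeSemigroup using (x∙yz≈y∙xz)

  indicator : Bool → ℕ
  indicator true  = 1
  indicator false = 0

  count : ∀ {n} → (Fin n → Bool) → ℕ
  count {ℕ.zero} P = 0
  count {suc n}  P = indicator (P zero) ℕ.+ count (P ∘ suc)

  count-split : ∀ {n} (x : Fin (suc n)) (P : Fin (suc n) → Bool) →
                count P ≡ indicator (P x) ℕ.+ count (P ∘ punchIn x)
  count-split zero P = refl
  count-split {suc n} (suc x) P = begin-equality
    indicator (P zero) ℕ.+ count (P ∘ suc)
      ≡⟨ cong (indicator (P zero) ℕ.+_) (count-split x (P ∘ suc)) ⟩
    indicator (P zero) ℕ.+ (indicator (P (suc x)) ℕ.+ count (P ∘ suc ∘ punchIn x))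
      ≡⟨ x∙yz≈y∙xz (indicator (P zero)) (indicator (P (suc x))) _ ⟩
    indicator (P (suc x)) ℕ.+ (indicator (P zero) ℕ.+ count (P ∘ suc ∘ punchIn x)) ∎

  indicator-mono : ∀ {a b : Bool} → (a ≡ true → b ≡ true) → indicator a ℕ.≤ indicator b
  indicator-mono {false} _ = ℕ.z≤n
  indicator-mono {true} a⇒b with a⇒b refl
  ... | refl = ℕ.≤-refl

  count-≤ : ∀ {n} (P Q : Fin n → Bool) (f : Fin n → Fin n) → Injective _≡_ _≡_ f →
            (∀ a → P a ≡ true → Q (f a) ≡ true) → count P ℕ.≤ count Q
  count-≤ {ℕ.zero} P Q f f-inj P⇒Qf = ℕ.z≤n
  count-≤ {suc n} P Q f f-inj P⇒Qf = begin
    indicator (P zero) ℕ.+ count (P ∘ suc)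
      ≤⟨ ℕ.+-mono-≤ (indicator-mono (P⇒Qf zero))
                    (count-≤ (P ∘ suc) (Q ∘ punchIn (f zero)) f′ f′-inj P⇒Qf′) ⟩
    indicator (Q (f zero)) ℕ.+ count (Q ∘ punchIn (f zero))
      ≡⟨ count-split (f zero) Q ⟨
    count Q ∎
    where
    f0≢ : ∀ j → f zero ≢ f (suc j)
    f0≢ j e with f-inj e
    ... | ()
    f′ : Fin n → Fin n
    f′ j = punchOut (f0≢ j)
    f′-inj : Injective _≡_ _≡_ f′
    f′-inj {a} {b} e with f-inj (punchOut-injective (f0≢ a) (f0≢ b) e)
    ... | refl = refl
    P⇒Qf′ : ∀ a → P (suc a) ≡ true → Q (punchIn (f zero) (f′ a)) ≡ true
    P⇒Qf′ a Pa = subst (λ z → Q z ≡ true) (sym (punchIn-punchOut (f0≢ a))) (P⇒Qf (suc a) Pa)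

  closed⇒co-closed : ∀ {n} (W : Fin n → Set) → (∀ a → Dec (W a)) →
                     (f : Fin n → Fin n) → Injective _≡_ _≡_ f →
                     (∀ a → W a → W (f a)) → ∀ r → ¬ W r → ¬ W (f r)
  closed⇒co-closed {suc n} W W? f f-inj W-closed r ¬Wr Wfr = ℕ.<-irrefl refl count-w<count-w
    where
    w W∪r : Fin (suc n) → Bool
    w a = does (W? a)
    W∪r a = w a ∨ does (a ≟ r)
    w-true : ∀ {a} → W a → w a ≡ true
    w-true {a} Wa with W? a
    ... | yes _ = refl
    ... | no ¬Wa = contradiction Wa ¬Wa
    W∪r⇒Wf : ∀ a → W∪r a ≡ true → w (f a) ≡ true
    W∪r⇒Wf a h with W? a | a ≟ r
    ... | yes Wa | _      = w-true (W-closed a Wa)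
    ... | no _   | yes refl = w-true Wfr
    W∪r⇒Wf a () | no _ | no _
    w-r : w r ≡ false
    w-r with W? r
    ... | yes Wr = contradiction Wr ¬Wr
    ... | no _ = refl
    W∪r-r : W∪r r ≡ true
    W∪r-r with w r | r ≟ r
    ... | true  | _ = refl
    ... | false | yes _ = refl
    ... | false | no r≢r = contradiction refl r≢r
    w⇒W∪r : ∀ j → w (punchIn r j) ≡ true → W∪r (punchIn r j) ≡ true
    w⇒W∪r j e rewrite e = refl
    count-w<count-w : count w ℕ.< count w
    count-w<count-w = begin-strict
      count w
        ≡⟨ count-split r w ⟩
      indicator (w r) ℕ.+ count (w ∘ punchIn r)
        ≡⟨ cong (λ b → indicator b ℕ.+ count (w ∘ punchIn r)) w-r ⟩
      count (w ∘ punchIn r)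
        <⟨ ℕ.s≤s (count-≤ _ _ (λ j → j) (λ e → e) w⇒W∪r) ⟩
      1 ℕ.+ count (W∪r ∘ punchIn r)
        ≡⟨ cong (λ b → indicator b ℕ.+ count (W∪r ∘ punchIn r)) W∪r-r ⟨
      indicator (W∪r r) ℕ.+ count (W∪r ∘ punchIn r)
        ≡⟨ count-split r W∪r ⟨
      count W∪r
        ≤⟨ count-≤ W∪r w f f-inj W∪r⇒Wf ⟩
      count w ∎

open Counting using (closed⇒co-closed)

module OffRow {n : ℕ} {_≺_ : Rel (Fin n) 0ℓ} (O : IsStrictTotalOrder _≡_ _≺_)
  (v : Permutation′ n)
  (av2143 : Quadrants.Avoids2143 O (v ⟨$⟩ʳ_)) (av1324 : Quadrants.Avoids1324 O (v ⟨$⟩ʳ_))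
  where
  open Quadrants O

  v[_] : Fin n → Fin n
  v[ a ] = v ⟨$⟩ʳ a

  module _ (τ : Permutation′ n) (i : Fin n) (τi≡vi : τ ⟨$⟩ʳ i ≡ v[ i ])
           (τ-SE : ∀ a → SE v[_] a (τ ⟨$⟩ʳ a))
           (r : Fin n) (r≢i : r ≢ i) (r-NW : NW v[_] r (τ ⟨$⟩ʳ r)) where

    OffRowWitness : Fin n → Set
    OffRowWitness a = a ≢ i × a ≼ r × v[ a ] ≼ τ ⟨$⟩ʳ r

    module Refutation (none : ∀ a → ¬ OffRowWitness a) where
      c p y : Fin n
      c = τ ⟨$⟩ʳ r
      p = v[ i ]
      y = v ⟨$⟩ˡ c

      vy≡c : v[ y ] ≡ c
      vy≡c = inverseʳ v

      right-of-c : ∀ {a} → a ≼ r → a ≢ i → c ≺ v[ a ]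
      right-of-c {a} a≼r a≢i with ≼⊎≻ v[ a ] c
      ... | inj₁ va≼c = contradiction (a≢i , a≼r , va≼c) (none a)
      ... | inj₂ c≺va = c≺va

      i≼r×p≼c : i ≼ r × p ≼ c
      i≼r×p≼c = in-row-i r-NW
        where
        in-row-i : NW v[_] r c → i ≼ r × p ≼ c
        in-row-i (a , a≼r , va≼c) with a ≟ i
        ... | yes refl = a≼r , va≼c
        ... | no a≢i   = contradiction (a≢i , a≼r , va≼c) (none a)

      i≺r : i ≺ r
      i≺r = ≼∧≢⇒≺ (proj₁ i≼r×p≼c) (r≢i ∘ sym)

      p≺c : p ≺ c
      p≺c = ≼∧≢⇒≺ (proj₂ i≼r×p≼c)
              λ p≡c → r≢i (sym (⟨$⟩ʳ-injective τ (trans τi≡vi p≡c)))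

      r≺y : r ≺ y
      r≺y with ≼⊎≻ y r
      ... | inj₂ r≺y = r≺y
      ... | inj₁ y≼r = contradiction (right-of-c y≼r y≢i) (≺-irrefl (sym vy≡c))
        where
        y≢i : y ≢ i
        y≢i y≡i = ≺-irrefl (trans (cong v[_] (sym y≡i)) vy≡c) p≺c

      W : Fin n → Set
      W a = ∃ λ b → b ≼ a × r ≺ b × v[ b ] ≼ c

      W? : ∀ a → Dec (W a)
      W? a = any? λ b → (b ≼? a) ×-dec (r ≺? b) ×-dec (v[ b ] ≼? c)

      W-up : ∀ {a a′} → W a → a ≼ a′ → W a′
      W-up (b , b≼a , r≺b , vb≼c) a≼a′ = b , ≼-trans b≼a a≼a′ , r≺b , vb≼c

      W-y : W y
      W-y = y , inj₂ refl , r≺y , inj₂ vy≡c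

      ¬W-r : ¬ W r
      ¬W-r (b , b≼r , r≺b , _) = ≼⇒≯ b≼r r≺b

      ¬W-i : ¬ W i
      ¬W-i (b , b≼i , r≺b , _) = ≼⇒≯ b≼i (≺-trans i≺r r≺b)

      -- W is an up-set, so rows outside W come before rows inside.
      before-W : ∀ {a b} → ¬ W b → W a → b ≺ a
      before-W {a} {b} ¬Wb Wa with ≼⊎≻ a b
      ... | inj₁ a≼b = contradiction (W-up Wa a≼b) ¬Wb
      ... | inj₂ b≺a = b≺a

      right-of-c-outside-W : ∀ {b} → ¬ W b → b ≢ i → c ≺ v[ b ]
      right-of-c-outside-W {b} ¬Wb b≢i with ≼⊎≻ b r
      ... | inj₁ b≼r = right-of-c b≼r b≢i
      ... | inj₂ r≺b with ≼⊎≻ v[ b ] c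
      ...   | inj₁ vb≼c = contradiction (b , inj₂ refl , r≺b , vb≼c) ¬Wb
      ...   | inj₂ c≺vb = c≺vb

      Escort : Fin n → Set
      Escort a = ∃ λ e → i ≺ e × ¬ W e × c ≺ v[ e ] × v[ e ] ≺ v[ a ]

      -- (2143) A row of W whose value exceeds that of some row outside
      -- W ∪ {i} has an escort.
      escort : ∀ {a b} → W a → ¬ W b → b ≢ i → v[ b ] ≺ v[ a ] → Escort a
      escort {a} {b} Wa ¬Wb b≢i vb≺va with compare i b
      ... | tri< i≺b _ _ = b , i≺b , ¬Wb , right-of-c-outside-W ¬Wb b≢i , vb≺va
      ... | tri≈ _ i≡b _ = contradiction (sym i≡b) b≢i
      ... | tri> _ _ b≺i with compare v[ r ] v[ a ]
      ...   | tri< vr≺va _ _ = r , i≺r , ¬W-r , right-of-c (inj₂ refl) r≢i , vr≺va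
      ...   | tri≈ _ vr≡va _ = contradiction (subst W (sym (⟨$⟩ʳ-injective v vr≡va)) Wa) ¬W-r
      ...   | tri> _ _ va≺vr =
              ⊥-elim (av2143 b≺i i≺r (before-W ¬W-r Wa)
                             (≺-trans p≺c (right-of-c-outside-W ¬Wb b≢i)) vb≺va va≺vr)

      -- (1324 and 2143) No row of W has an escort.  The case split is on
      -- the position of the row y of value c relative to a.
      no-escort : ∀ {a} → W a → ¬ Escort a
      no-escort {a} (b , b≼a , r≺b , vb≼c) (e , i≺e , ¬We , c≺ve , ve≺va) = by-position-of-y (compare y a)
        where
        c≺va : c ≺ v[ a ]
        c≺va = ≺-trans c≺ve ve≺va
        p≺vy : p ≺ v[ y ]
        p≺vy = subst (p ≺_) (sym vy≡c) p≺c
        b≺a : b ≺ a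
        b≺a = ≼∧≢⇒≺ b≼a λ { refl → ≼⇒≯ vb≼c c≺va }
        -- if a ≺ y, then b plays the role of the '2' in 1324 or of the '1' in 2143
        by-value-of-b : a ≺ y → Tri (p ≺ v[ b ]) (p ≡ v[ b ]) (v[ b ] ≺ p) → ⊥
        by-value-of-b a≺y (tri< p≺vb _ _) =
          av1324 i≺e (before-W ¬We (b , inj₂ refl , r≺b , vb≼c)) b≺a
                 p≺vb (≼-≺-trans vb≼c c≺ve) ve≺va
        by-value-of-b a≺y (tri≈ _ p≡vb _) =
          ≺-irrefl (⟨$⟩ʳ-injective v p≡vb) (≺-trans i≺r r≺b)
        by-value-of-b a≺y (tri> _ _ vb≺p) =
          av2143 (≺-trans i≺r r≺b) b≺a a≺y vb≺p p≺vy (subst (_≺ v[ a ]) (sym vy≡c) c≺va)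
        by-position-of-y : Tri (y ≺ a) (y ≡ a) (a ≺ y) → ⊥
        by-position-of-y (tri< y≺a _ _) =
          av1324 i≺e (before-W ¬We W-y) y≺a p≺vy (subst (_≺ v[ e ]) (sym vy≡c) c≺ve) ve≺va
        by-position-of-y (tri≈ _ y≡a _) = ≺-irrefl (trans (sym vy≡c) (cong v[_] y≡a)) c≺va
        by-position-of-y (tri> _ _ a≺y) = by-value-of-b a≺y (compare p v[ b ])

      W-below : ∀ {a b} → W a → ¬ W b → b ≢ i → v[ a ] ≺ v[ b ]
      W-below {a} {b} Wa ¬Wb b≢i with compare v[ a ] v[ b ]
      ... | tri< va≺vb _ _ = va≺vb
      ... | tri≈ _ va≡vb _ = contradiction (subst W (⟨$⟩ʳ-injective v va≡vb) Wa) ¬Wb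
      ... | tri> _ _ vb≺va = contradiction (escort Wa ¬Wb b≢i vb≺va) (no-escort Wa)

      -- The injection f = v⁻¹ ∘ τ maps W into W, although f r = y ∈ W while
      -- r ∉ W: impossible by pigeonhole.
      f : Fin n → Fin n
      f a = v ⟨$⟩ˡ (τ ⟨$⟩ʳ a)

      W-closed : ∀ a → W a → W (f a)
      W-closed a Wa with W? (f a) | τ-SE a
      ... | yes Wfa | _ = Wfa
      ... | no ¬Wfa | a′ , a′≽a , va′≽τa =
            ⊥-elim (≼⇒≯ (≽⇒≼ va′≽τa)
              (subst (v[ a′ ] ≺_) (inverseʳ v) (W-below (W-up Wa (≽⇒≼ a′≽a)) ¬Wfa fa≢i)))
        where
        fa≢i : f a ≢ i
        fa≢i fa≡i = ¬W-i (subst W a≡i Wa)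
          where
          a≡i : a ≡ i
          a≡i = ⟨$⟩ʳ-injective τ (trans (sym (inverseʳ v)) (trans (cong v[_] fa≡i) (sym τi≡vi)))

      absurd : ⊥
      absurd = closed⇒co-closed W W? f (⟨$⟩ʳ-injective τ ∘ ⟨$⟩ˡ-injective v) W-closed r ¬W-r W-y

    off-row-witness : ∃ OffRowWitness
    off-row-witness with any? (λ a → ¬? (a ≟ i) ×-dec (a ≼? r) ×-dec (v[ a ] ≼? (τ ⟨$⟩ʳ r)))
    ... | yes witness = witness
    ... | no ¬witness = ⊥-elim (Refutation.absurd (λ a w → ¬witness (a , w)))

open Std using (_≼_; _≽_; ≽⇒≼; ≼⇒≽; ≼-≺-trans; ≺-≼-trans; ≼⇒≯; ≼∧≢⇒≺; NW; SE)

Band : ∀ {n} → Permutation′ n → Cells n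
Band u r c = NW (u ⟨$⟩ʳ_) r c × SE (u ⟨$⟩ʳ_) r c

own-band : ∀ {n} (u : Permutation′ n) r c → u ⟨$⟩ʳ r ≡ c → Band u r c
own-band u r c ur≡c = (r , inj₂ refl , inj₂ ur≡c) , (r , inj₂ refl , inj₂ ur≡c)

transpose-a : ∀ {n} (a b : Fin n) → PC.transpose a b a ≡ b
transpose-a a b with a ≟ a
... | yes _ = refl
... | no a≢a = contradiction refl a≢a

transpose-b : ∀ {n} (a b : Fin n) → PC.transpose a b b ≡ a
transpose-b a b with b ≟ a
... | yes b≡a = b≡a
... | no _ with b ≟ b
...   | yes _ = refl
...   | no b≢b = contradiction refl b≢b

transpose-other : ∀ {n} (a b k : Fin n) → k ≢ a → k ≢ b → PC.transpose a b k ≡ k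
transpose-other a b k k≢a k≢b with k ≟ a
... | yes k≡a = contradiction k≡a k≢a
... | no _ with k ≟ b
...   | yes k≡b = contradiction k≡b k≢b
...   | no _ = refl

module _ {n} {u w : Permutation′ n} (step : BruhatStep u w) where
  private
    a b : Fin n
    a = proj₁ step
    b = proj₁ (proj₂ step)
    a<b : a < b
    a<b = proj₁ (proj₂ (proj₂ step))
    ua<ub : u ⟨$⟩ʳ a < u ⟨$⟩ʳ b
    ua<ub = proj₁ (proj₂ (proj₂ (proj₂ step)))
    w≡ : ∀ k → w ⟨$⟩ʳ k ≡ u ⟨$⟩ʳ PC.transpose a b k
    w≡ = proj₂ (proj₂ (proj₂ (proj₂ step)))
    wa≡ub : w ⟨$⟩ʳ a ≡ u ⟨$⟩ʳ b
    wa≡ub = trans (w≡ a) (cong (u ⟨$⟩ʳ_) (transpose-a a b))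
    wb≡ua : w ⟨$⟩ʳ b ≡ u ⟨$⟩ʳ a
    wb≡ua = trans (w≡ b) (cong (u ⟨$⟩ʳ_) (transpose-b a b))
    wk≡uk : ∀ {k} → k ≢ a → k ≢ b → w ⟨$⟩ʳ k ≡ u ⟨$⟩ʳ k
    wk≡uk {k} k≢a k≢b = trans (w≡ k) (cong (u ⟨$⟩ʳ_) (transpose-other a b k k≢a k≢b))

  step-NW : ∀ {r c} → NW (w ⟨$⟩ʳ_) r c → NW (u ⟨$⟩ʳ_) r c
  step-NW {r} {c} (k , k≼r , wk≼c) with k ≟ a | k ≟ b
  ... | yes refl | _        = a , k≼r , inj₁ (≺-≼-trans ua<ub (subst (_≼ c) wa≡ub wk≼c))
  ... | no _     | yes refl = a , inj₁ (≺-≼-trans a<b k≼r) , subst (_≼ c) wb≡ua wk≼c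
  ... | no k≢a   | no k≢b   = k , k≼r , subst (_≼ c) (wk≡uk k≢a k≢b) wk≼c

  step-SE : ∀ {r c} → SE (w ⟨$⟩ʳ_) r c → SE (u ⟨$⟩ʳ_) r c
  step-SE {r} {c} (k , k≽r , wk≽c) with k ≟ a | k ≟ b
  ... | yes refl | _        = b , inj₁ (≼-≺-trans (≽⇒≼ k≽r) a<b) , subst (_≽ c) wa≡ub wk≽c
  ... | no _     | yes refl =
        b , k≽r , inj₁ (≼-≺-trans (≽⇒≼ (subst (_≽ c) wb≡ua wk≽c)) ua<ub)
  ... | no k≢a   | no k≢b   = k , k≽r , subst (_≽ c) (wk≡uk k≢a k≢b) wk≽c

band-antitone : ∀ {n} {u w : Permutation′ n} {r c} → u ≤B w → Band w r c → Band u r c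
band-antitone ε           band = band
band-antitone {u = u} (_◅_ {j = v} step ≤w) band with band-antitone ≤w band
... | nw , se = step-NW {u = u} {v} step nw , step-SE {u = u} {v} step se

Γ⇒Band : ∀ {n} {u : Permutation′ n} {r c} → Γ u r c → Band u r c
Γ⇒Band (u′ , u≤u′ , u′r≡c) = band-antitone u≤u′ (own-band u′ _ _ u′r≡c)

swap : ∀ {n} → Permutation′ n → Fin n → Fin n → Permutation′ n
swap u a b = transpose a b ∘ₚ u

swap-up : ∀ {n} (u : Permutation′ n) {a b} → a < b → u ⟨$⟩ʳ a < u ⟨$⟩ʳ b → u ≤B swap u a b
swap-up u a<b ua<ub = (_ , _ , a<b , ua<ub , λ _ → refl) ◅ ε

-- Conversely each cell (r, c) of the band is reached in at most two steps.
-- Let d be the row with u d = c.  If d < r we use the south-east entry of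
-- the band, if r < d the north-west one.
module _ {n} (u : Permutation′ n) {r c : Fin n} where
  private
    d : Fin n
    d = u ⟨$⟩ˡ c
    ud≡c : u ⟨$⟩ʳ d ≡ c
    ud≡c = inverseʳ u

  reach-from-left : d < r → SE (u ⟨$⟩ʳ_) r c → Γ u r c
  reach-from-left d<r (b , b≽r , ub≽c) with <-cmp c (u ⟨$⟩ʳ r)
  ... | tri< c<ur _ _ =
        swap u d r , swap-up u d<r (subst (_< u ⟨$⟩ʳ r) (sym ud≡c) c<ur) ,
        trans (cong (u ⟨$⟩ʳ_) (transpose-b d r)) ud≡c
  ... | tri≈ _ c≡ur _ = u , ε , sym c≡ur
  ... | tri> _ _ ur<c =
        swap w₁ r b ,
        swap-up u d<b (subst (_< u ⟨$⟩ʳ b) (sym ud≡c) c<ub) ◅◅ swap-up w₁ r<b w₁r<w₁b ,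
        trans (cong (w₁ ⟨$⟩ʳ_) (transpose-a r b)) w₁b≡c
    where
    r<b : r < b
    r<b = ≼∧≢⇒≺ (≽⇒≼ b≽r) λ { refl → ≼⇒≯ (≽⇒≼ ub≽c) ur<c }
    d<b : d < b
    d<b = <-trans d<r r<b
    c<ub : c < u ⟨$⟩ʳ b
    c<ub = ≼∧≢⇒≺ (≽⇒≼ ub≽c) λ c≡ub → <-irrefl (⟨$⟩ʳ-injective u (trans ud≡c c≡ub)) d<b
    w₁ : Permutation′ n
    w₁ = swap u d b
    w₁b≡c : w₁ ⟨$⟩ʳ b ≡ c
    w₁b≡c = trans (cong (u ⟨$⟩ʳ_) (transpose-b d b)) ud≡c
    w₁r<w₁b : w₁ ⟨$⟩ʳ r < w₁ ⟨$⟩ʳ b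
    w₁r<w₁b = subst₂ _<_ (cong (u ⟨$⟩ʳ_) (sym (transpose-other d b r (<⇒≢ d<r ∘ sym) (<⇒≢ r<b))))
                         (sym w₁b≡c) ur<c

  reach-from-right : r < d → NW (u ⟨$⟩ʳ_) r c → Γ u r c
  reach-from-right r<d (a , a≼r , ua≼c) with <-cmp (u ⟨$⟩ʳ r) c
  ... | tri< ur<c _ _ =
        swap u r d , swap-up u r<d (subst (u ⟨$⟩ʳ r <_) (sym ud≡c) ur<c) ,
        trans (cong (u ⟨$⟩ʳ_) (transpose-a r d)) ud≡c
  ... | tri≈ _ ur≡c _ = u , ε , ur≡c
  ... | tri> _ _ c<ur =
        swap w₁ a r ,
        swap-up u a<d (subst (u ⟨$⟩ʳ a <_) (sym ud≡c) ua<c) ◅◅ swap-up w₁ a<r w₁a<w₁r ,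
        trans (cong (w₁ ⟨$⟩ʳ_) (transpose-b a r)) w₁a≡c
    where
    a<r : a < r
    a<r = ≼∧≢⇒≺ a≼r λ { refl → ≼⇒≯ ua≼c c<ur }
    a<d : a < d
    a<d = <-trans a<r r<d
    ua<c : u ⟨$⟩ʳ a < c
    ua<c = ≼∧≢⇒≺ ua≼c λ ua≡c → <-irrefl (⟨$⟩ʳ-injective u (trans ua≡c (sym ud≡c))) a<d
    w₁ : Permutation′ n
    w₁ = swap u a d
    w₁a≡c : w₁ ⟨$⟩ʳ a ≡ c
    w₁a≡c = trans (cong (u ⟨$⟩ʳ_) (transpose-a a d)) ud≡c
    w₁a<w₁r : w₁ ⟨$⟩ʳ a < w₁ ⟨$⟩ʳ r
    w₁a<w₁r = subst₂ _<_ (sym w₁a≡c)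
                         (cong (u ⟨$⟩ʳ_) (sym (transpose-other a d r (<⇒≢ a<r ∘ sym) (<⇒≢ r<d))))
                         c<ur

  Band⇒Γ : Band u r c → Γ u r c
  Band⇒Γ (nw , se) with <-cmp d r
  ... | tri< d<r _ _ = reach-from-left d<r se
  ... | tri≈ _ refl _ = u , ε , ud≡c
  ... | tri> _ _ r<d = reach-from-right r<d nw

insert-at : ∀ {n} (i j : Fin (suc n)) (π : Permutation′ n) →
            insert i j π ⟨$⟩ʳ i ≡ j
insert-at i j π with i ≟ i
... | yes _ = refl
... | no i≢i = contradiction refl i≢i

Supported : ∀ {n} → Cells n → Permutation′ n → Set
Supported P σ = ∀ r → P r (σ ⟨$⟩ʳ r)

minor : ∀ {n} → Cells (suc n) → Fin (suc n) → Cells n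
minor P j r c = P (suc r) (punchIn j c)

minor? : ∀ {n} {P : Cells (suc n)} → (∀ r c → Dec (P r c)) → ∀ j r c → Dec (minor P j r c)
minor? P? j r c = P? (suc r) (punchIn j c)

extend-supported : ∀ {n} (P : Cells (suc n)) j {σ : Permutation′ n} →
                   P zero j → Supported (minor P j) σ → Supported P (insert zero j σ)
extend-supported P j {σ} P0j σ-minor zero = subst (P zero) (sym (insert-at zero j σ)) P0j
extend-supported P j {σ} P0j σ-minor (suc r) =
  subst (P (suc r)) (sym (insert-punchIn zero j σ r)) (σ-minor r)

module Determinant {c ℓ : Level} (R : CommutativeRing c ℓ) where
  open CommutativeRing R
    using (Carrier; _≈_; _*_; 0#; +-cong; *-congˡ; +-identityˡ; zeroˡ; zeroʳ)
    renaming (refl to ≈-refl; sym to ≈-sym; trans to ≈-trans)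
  open Matrices R

  minorMatrix : ∀ {n} → Matrix (suc n) → Fin (suc n) → Matrix n
  minorMatrix M j r c = M (suc r) (punchIn j c)

  sumFin-cong : ∀ {n} {f g : Fin n → Carrier} → (∀ j → f j ≈ g j) → sumFin f ≈ sumFin g
  sumFin-cong {ℕ.zero} f≈g = ≈-refl
  sumFin-cong {suc n}  f≈g = +-cong (f≈g zero) (sumFin-cong (f≈g ∘ suc))

  sumFin-zero : ∀ {n} {f : Fin n → Carrier} → (∀ j → f j ≈ 0#) → sumFin f ≈ 0#
  sumFin-zero {ℕ.zero} f≈0 = ≈-refl
  sumFin-zero {suc n}  f≈0 = ≈-trans (+-cong (f≈0 zero) (sumFin-zero (f≈0 ∘ suc))) (+-identityˡ 0#)

  term-zeroˡ : ∀ s m d → m ≈ 0# → s * (m * d) ≈ 0#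
  term-zeroˡ s m d m≈0 = ≈-trans (*-congˡ (≈-trans (*-congʳ m≈0) (zeroˡ d))) (zeroʳ s)
    where open CommutativeRing R using (*-congʳ)

  term-zeroʳ : ∀ s m d → d ≈ 0# → s * (m * d) ≈ 0#
  term-zeroʳ s m d d≈0 = ≈-trans (*-congˡ (≈-trans (*-congˡ d≈0) (zeroʳ m))) (zeroʳ s)

  det-unsupported : ∀ {n} (P : Cells n) (P? : ∀ r c → Dec (P r c)) (M : Matrix n) →
                    (∀ σ → ¬ Supported P σ) → det (restrict P P? M) ≈ 0#
  det-unsupported {ℕ.zero} P P? M none = contradiction (λ ()) (none id)
  det-unsupported {suc n}  P P? M none = sumFin-zero term
    where
    term : ∀ j → altSign j * (restrict P P? M zero j *
                   det (λ r c → restrict P P? M (suc r) (punchIn j c))) ≈ 0#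
    term j with P? zero j
    ... | no _    = term-zeroˡ _ _ _ ≈-refl
    ... | yes P0j = term-zeroʳ _ _ _
          (det-unsupported (minor P j) (minor? P? j) (minorMatrix M j)
             λ σ σ-minor → none (insert zero j σ) (extend-supported P j P0j σ-minor))

  det-restrict-cong : ∀ {n} (Q P : Cells n) (Q? : ∀ r c → Dec (Q r c)) (P? : ∀ r c → Dec (P r c))
                      (M : Matrix n) → (∀ r c → Q r c → P r c) →
                      (∀ σ → Supported P σ → Supported Q σ) →
                      det (restrict Q Q? M) ≈ det (restrict P P? M)
  det-restrict-cong {ℕ.zero} Q P Q? P? M Q⊆P P⇒Q = ≈-refl
  det-restrict-cong {suc n}  Q P Q? P? M Q⊆P P⇒Q = sumFin-cong term
    where
    extended-in-Q : ∀ {j} → P zero j → ∀ σ → Supported (minor P j) σ → Supported Q (insert zero j σ)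
    extended-in-Q {j} P0j σ σ-minor = P⇒Q (insert zero j σ) (extend-supported P j P0j σ-minor)
    minor-P⇒Q : ∀ {j} → P zero j → ∀ σ → Supported (minor P j) σ → Supported (minor Q j) σ
    minor-P⇒Q {j} P0j σ σ-minor r =
      subst (Q (suc r)) (insert-punchIn zero j σ r) (extended-in-Q P0j σ σ-minor (suc r))
    term : ∀ j → altSign j * (restrict Q Q? M zero j *
                   det (λ r c → restrict Q Q? M (suc r) (punchIn j c)))
               ≈ altSign j * (restrict P P? M zero j *
                   det (λ r c → restrict P P? M (suc r) (punchIn j c)))
    term j with Q? zero j | P? zero j
    ... | yes _   | yes P0j = *-congˡ (*-congˡ
          (det-restrict-cong (minor Q j) (minor P j) (minor? Q? j) (minor? P? j) (minorMatrix M j)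
                             (λ r c → Q⊆P (suc r) (punchIn j c))
                             (minor-P⇒Q P0j)))
    ... | yes Q0j | no ¬P0j = contradiction (Q⊆P zero j Q0j) ¬P0j
    ... | no _    | no _    = ≈-trans (term-zeroˡ _ _ _ ≈-refl) (≈-sym (term-zeroˡ _ _ _ ≈-refl))
    ... | no ¬Q0j | yes P0j = ≈-trans (term-zeroˡ _ _ _ ≈-refl) (≈-sym (term-zeroʳ _ _ _
          (det-unsupported (minor P j) (minor? P? j) (minorMatrix M j) λ σ σ-minor →
             ¬Q0j (subst (Q zero) (insert-at zero j σ) (extended-in-Q P0j σ σ-minor zero)))))

delRC⇒punchIn : ∀ {n} (P : Cells (suc n)) {i k r c} → delRC P i k r c → P (punchIn i r) (punchIn k c)
delRC⇒punchIn P (r′ , c′ , i≢r′ , k≢c′ , Pr′c′ , refl , refl) =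
  subst₂ P (sym (punchIn-punchOut i≢r′)) (sym (punchIn-punchOut k≢c′)) Pr′c′

punchIn⇒delRC : ∀ {n} (P : Cells (suc n)) {i k r c} → P (punchIn i r) (punchIn k c) → delRC P i k r c
punchIn⇒delRC P {i} {k} {r} {c} P-cell =
  punchIn i r , punchIn k c , punchInᵢ≢i i r ∘ sym , punchInᵢ≢i k c ∘ sym , P-cell ,
  punchOut-punchIn i , punchOut-punchIn k

punchIn-<-mono : ∀ {n} (i : Fin (suc n)) {j l : Fin n} → j < l → punchIn i j < punchIn i l
punchIn-<-mono i {j} {l} j<l =
  ≤∧≢⇒< (punchIn-mono-≤ i j l (ℕ.<⇒≤ j<l)) (<⇒≢ j<l ∘ punchIn-injective i j l)

punchIn-<-cancel : ∀ {n} (i : Fin (suc n)) {j l : Fin n} → punchIn i j < punchIn i l → j < l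
punchIn-<-cancel i {j} {l} j<l =
  ≤∧≢⇒< (punchIn-cancel-≤ i j l (ℕ.<⇒≤ j<l)) (<⇒≢ j<l ∘ cong (punchIn i))

punchIn-≼ : ∀ {n} (i : Fin (suc n)) {j l : Fin n} → j ≼ l → punchIn i j ≼ punchIn i l
punchIn-≼ i (inj₁ j<l)  = inj₁ (punchIn-<-mono i j<l)
punchIn-≼ i (inj₂ refl) = inj₂ refl

punchIn-≼⁻¹ : ∀ {n} (i : Fin (suc n)) {j l : Fin n} → punchIn i j ≼ punchIn i l → j ≼ l
punchIn-≼⁻¹ i         (inj₁ j<l) = inj₁ (punchIn-<-cancel i j<l)
punchIn-≼⁻¹ i {j} {l} (inj₂ j≡l) = inj₂ (punchIn-injective i j l j≡l)

punchIn-≽ : ∀ {n} (i : Fin (suc n)) {j l : Fin n} → j ≽ l → punchIn i j ≽ punchIn i l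
punchIn-≽ i = ≼⇒≽ ∘ punchIn-≼ i ∘ ≽⇒≼

punchIn-≽⁻¹ : ∀ {n} (i : Fin (suc n)) {j l : Fin n} → punchIn i j ≽ punchIn i l → j ≽ l
punchIn-≽⁻¹ i = ≼⇒≽ ∘ punchIn-≼⁻¹ i ∘ ≽⇒≼

module Deletion {m : ℕ} (v : Permutation′ (suc m)) (i : Fin (suc m)) where
  p : Fin (suc m)
  p = v ⟨$⟩ʳ i

  x : Permutation′ m
  x = remove i v

  D : Cells m
  D = delRC (Γ v) i p

  v-punchIn : ∀ j → v ⟨$⟩ʳ punchIn i j ≡ punchIn p (x ⟨$⟩ʳ j)
  v-punchIn = punchIn-permute v i

  band-lift : ∀ {r c} → Band x r c → Band v (punchIn i r) (punchIn p c)
  band-lift {r} {c} ((a , a≼r , xa≼c) , (b , b≽r , xb≽c)) =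
    (punchIn i a , punchIn-≼ i a≼r , subst (_≼ punchIn p c) (sym (v-punchIn a)) (punchIn-≼ p xa≼c)) ,
    (punchIn i b , punchIn-≽ i b≽r , subst (_≽ punchIn p c) (sym (v-punchIn b)) (punchIn-≽ p xb≽c))

  Γx⊆D : ∀ r c → Γ x r c → D r c
  Γx⊆D r c = punchIn⇒delRC (Γ v) ∘ Band⇒Γ v ∘ band-lift ∘ Γ⇒Band

  NW-descends : ∀ {a r c} → a ≢ i → a ≼ punchIn i r → v ⟨$⟩ʳ a ≼ punchIn p c →
                NW (x ⟨$⟩ʳ_) r c
  NW-descends {a} {r} {c} a≢i a≼r va≼c =
    punchOut i≢a ,
    punchIn-≼⁻¹ i (subst (_≼ punchIn i r) (sym (punchIn-punchOut i≢a)) a≼r) ,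
    punchIn-≼⁻¹ p (subst (_≼ punchIn p c) (trans (cong (v ⟨$⟩ʳ_) (sym (punchIn-punchOut i≢a)))
                                                 (v-punchIn (punchOut i≢a))) va≼c)
    where
    i≢a : i ≢ a
    i≢a = a≢i ∘ sym

  SE-descends : ∀ {a r c} → a ≢ i → a ≽ punchIn i r → v ⟨$⟩ʳ a ≽ punchIn p c →
                SE (x ⟨$⟩ʳ_) r c
  SE-descends {a} {r} {c} a≢i a≽r va≽c =
    punchOut i≢a ,
    punchIn-≽⁻¹ i (subst (_≽ punchIn i r) (sym (punchIn-punchOut i≢a)) a≽r) ,
    punchIn-≽⁻¹ p (subst (_≽ punchIn p c) (trans (cong (v ⟨$⟩ʳ_) (sym (punchIn-punchOut i≢a)))
                                                 (v-punchIn (punchOut i≢a))) va≽c)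
    where
    i≢a : i ≢ a
    i≢a = a≢i ∘ sym

  module _ (¬2143 : ¬ Contains2143 v) (¬1324 : ¬ Contains1324 v)
           (σ : Permutation′ m) (σ-D : Supported D σ) where
    τ : Permutation′ (suc m)
    τ = insert i p σ

    τ-band : ∀ a → Band v a (τ ⟨$⟩ʳ a)
    τ-band a = by-row (i ≟ a)
      where
      by-row : Dec (i ≡ a) → Band v a (τ ⟨$⟩ʳ a)
      by-row (yes refl) = subst (Band v i) (sym (insert-at i p σ)) (own-band v i p refl)
      by-row (no i≢a) = subst (λ a → Band v a (τ ⟨$⟩ʳ a)) (punchIn-punchOut i≢a)
                              (τ-band-punchIn (punchOut i≢a))
        where
        τ-band-punchIn : ∀ r → Band v (punchIn i r) (τ ⟨$⟩ʳ punchIn i r)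
        τ-band-punchIn r = subst (Band v (punchIn i r)) (sym (insert-punchIn i p σ r))
                                 (Γ⇒Band (delRC⇒punchIn (Γ v) (σ-D r)))

    nw-off-row : ∀ r → ∃ λ a → a ≢ i × a ≼ punchIn i r × v ⟨$⟩ʳ a ≼ τ ⟨$⟩ʳ punchIn i r
    nw-off-row r =
      OffRow.off-row-witness <-isStrictTotalOrder v (avoids2143 {v = v} ¬2143) (avoids1324 {v = v} ¬1324)
        τ i (insert-at i p σ) (proj₂ ∘ τ-band)
        (punchIn i r) (punchInᵢ≢i i r) (proj₁ (τ-band (punchIn i r)))

    se-off-row : ∀ r → ∃ λ a → a ≢ i × a ≽ punchIn i r × v ⟨$⟩ʳ a ≽ τ ⟨$⟩ʳ punchIn i r
    se-off-row r =
      OffRow.off-row-witness reversed v (avoids2143ʳ {v = v} ¬2143) (avoids1324ʳ {v = v} ¬1324)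
        τ i (insert-at i p σ) (proj₁ ∘ τ-band)
        (punchIn i r) (punchInᵢ≢i i r) (proj₂ (τ-band (punchIn i r)))

    σ-band : ∀ r → Band x r (σ ⟨$⟩ʳ r)
    σ-band r with nw-off-row r | se-off-row r
    ... | a , a≢i , a≼r , va≼τr | b , b≢i , b≽r , vb≽τr =
          NW-descends a≢i a≼r (subst (v ⟨$⟩ʳ a ≼_) (insert-punchIn i p σ r) va≼τr) ,
          SE-descends b≢i b≽r (subst (v ⟨$⟩ʳ b ≽_) (insert-punchIn i p σ r) vb≽τr)

    σ-Γx : Supported (Γ x) σ
    σ-Γx r = Band⇒Γ x (σ-band r)

proposition3p14 : ∀ {c ℓ : Level} (R : CommutativeRing c ℓ) (m : ℕ)
    (v : Permutation′ (suc m)) →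
    ¬ Contains2143 v → ¬ Contains1324 v →
    (i : Fin (suc m)) →
    let open Matrices R
        x = remove i v
    in (decX : ∀ r c → Dec (Γ x r c)) →
       (decV : ∀ r c → Dec (delRC (Γ v) i (v ⟨$⟩ʳ i) r c)) →
       (M : Matrix m) →
       CommutativeRing._≈_ R (det (restrict (Γ x) decX M))
                             (det (restrict (delRC (Γ v) i (v ⟨$⟩ʳ i)) decV M))
proposition3p14 R m v ¬2143 ¬1324 i decX decV M =
  det-restrict-cong (Γ x) D decX decV M Γx⊆D (σ-Γx ¬2143 ¬1324)
  where
  open Determinant R
  open Deletion v i
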